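{- Let $I_4=\{1,2,3,4\}$, let $\mathfrak{N}$ be a Veblen configuration defined on $\wp_2(I_4)$, and let $\varphi\in S_{I_4}$. Then there is no $\sigma\in S_{I_4}$ and no Veblen configuration $\mathfrak{N}'$ defined on $\wp_2(I_4)$ such that $\mathbf{\Pi}(p,\bar\varphi\varkappa,\mathfrak{N})\cong\mathbf{\Pi}(p,\bar\sigma,\mathfrak{N}')$.
   Context: $\wp_2(I_4)$ is the set of 2-element subsets of $I_4$ and $S_{I_4}$ the group of permutations of $I_4$. For $\varphi\in S_{I_4}$, $\bar\varphi$ is the induced bijection $\{i,j\}\mapsto\{\varphi(i),\varphi(j)\}$ of $\wp_2(I_4)$; $\varkappa(u)=I_4\setminus u$ for $u\in\wp_2(I_4)$. A Veblen configuration on $\wp_2(I_4)$ is a family of four 3-element subsets of $\wp_2(I_4)$ ("lines") such that every element of $\wp_2(I_4)$ lies on exactly two lines and any two lines meet in exactly one element. Take pairwise distinct symbols $p$, $a_i,b_i$ ($i\in I_4$), $c_u$ ($u\in\wp_2(I_4)$). For a bijection $\delta$ of $\wp_2(I_4)$ (here of the form $\bar\sigma$ or $\bar\sigma\circ\varkappa$ with $\sigma\in S_{I_4}$), $\mathbf{\Pi}(p,\delta,\mathfrak{N})$ is the incidence structure with points $p,a_i,b_i,c_u$ and lines: $\{c_u:u\in L\}$ for each line $L$ of $\mathfrak{N}$; $\{a_i,a_j,c_{\{i,j\}}\}$ and $\{b_i,b_j,c_{\delta^{ -1}(\{i,j\})}\}$ for $\{i,j\}\in\wp_2(I_4)$;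 and $\{p,a_i,b_i\}$ for $i\in I_4$. $\cong$ denotes isomorphism of incidence structures (a bijection of points mapping lines onto lines). -}

module Defs where

open import Data.Bool using (Bool; true; false; if_then_else_; _∧_)
open import Data.Nat using (ℕ; _+_)
open import Data.Fin using (Fin; zero; suc)
open import Data.Fin.Permutation using (Permutation′; _⟨$⟩ʳ_; _⟨$⟩ˡ_; inverseˡ)
open import Data.List using (List; []; _∷_; map)
open import Data.Nat.ListAction using (sum)
open import Data.Product using (Σ; _×_; _,_; proj₁; proj₂)
open import Data.Empty using (⊥-elim)
open import Function using (_∘_; _⇔_)
open import Relation.Binary.PropositionalEquality using (_≡_; _≢_; refl; cong; sym; trans)
open import Function.Bundles using (_↔_; Inverse)
import Data.Empty
import Data.Sum
import Data.Unit

-- I₄ = {1,2,3,4} is represented by Fin 4 (0 ↦ 1, …, 3 ↦ 4).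
I₄ : Set
I₄ = Fin 4

-- ℘₂(I₄): the six 2-element subsets {i,j} (listed with i < j).
data P2 : Set where
  p01 p02 p03 p12 p13 p23 : P2

allP2 : List P2
allP2 = p01 ∷ p02 ∷ p03 ∷ p12 ∷ p13 ∷ p23 ∷ []

allI₄ : List I₄
allI₄ = zero ∷ suc zero ∷ suc (suc zero) ∷ suc (suc (suc zero)) ∷ []

elems : P2 → I₄ × I₄
elems p01 = zero , suc zero
elems p02 = zero , suc (suc zero)
elems p03 = zero , suc (suc (suc zero))
elems p12 = suc zero , suc (suc zero)
elems p13 = suc zero , suc (suc (suc zero))
elems p23 = suc (suc zero) , suc (suc (suc zero))

pair : (i j : I₄) → i ≢ j → P2
pair zero zero ne = ⊥-elim (ne refl)
pair zero (suc zero) _ = p01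
pair zero (suc (suc zero)) _ = p02
pair zero (suc (suc (suc zero))) _ = p03
pair (suc zero) zero _ = p01
pair (suc zero) (suc zero) ne = ⊥-elim (ne refl)
pair (suc zero) (suc (suc zero)) _ = p12
pair (suc zero) (suc (suc (suc zero))) _ = p13
pair (suc (suc zero)) zero _ = p02
pair (suc (suc zero)) (suc zero) _ = p12
pair (suc (suc zero)) (suc (suc zero)) ne = ⊥-elim (ne refl)
pair (suc (suc zero)) (suc (suc (suc zero))) _ = p23
pair (suc (suc (suc zero))) zero _ = p03
pair (suc (suc (suc zero))) (suc zero) _ = p13
pair (suc (suc (suc zero))) (suc (suc zero)) _ = p23
pair (suc (suc (suc zero))) (suc (suc (suc zero))) ne = ⊥-elim (ne refl)

elems-≢ : (u : P2) → proj₁ (elems u) ≢ proj₂ (elems u)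
elems-≢ p01 ()
elems-≢ p02 ()
elems-≢ p03 ()
elems-≢ p12 ()
elems-≢ p13 ()
elems-≢ p23 ()

S₄ : Set
S₄ = Permutation′ 4

perm-inj : (φ : S₄) {i j : I₄} → φ ⟨$⟩ʳ i ≡ φ ⟨$⟩ʳ j → i ≡ j
perm-inj φ {i} {j} e = trans (sym (inverseˡ φ {i})) (trans (cong (φ ⟨$⟩ˡ_) e) (inverseˡ φ {j}))

bar : S₄ → P2 → P2
bar φ u = pair (φ ⟨$⟩ʳ proj₁ (elems u)) (φ ⟨$⟩ʳ proj₂ (elems u))
               (elems-≢ u ∘ perm-inj φ)

-- ϰ(u) = I₄ ∖ u
ϰ : P2 → P2
ϰ p01 = p23
ϰ p02 = p13
ϰ p03 = p12
ϰ p12 = p03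
ϰ p13 = p02
ϰ p23 = p01

count : {A : Set} → List A → (A → Bool) → ℕ
count xs f = sum (map (λ x → if f x then 1 else 0) xs)

record Veblen : Set where
  field
    line      : Fin 4 → P2 → Bool
    three     : ∀ k → count allP2 (line k) ≡ 3
    twoLines  : ∀ u → count allI₄ (λ k → line k u) ≡ 2
    meetOne   : ∀ k l → k ≢ l → count allP2 (λ u → line k u ∧ line l u) ≡ 1
open Veblen public

data Pt : Set where
  pp : Pt
  a  : I₄ → Pt
  b  : I₄ → Pt
  c  : P2 → Pt

data Ln : Set where
  cL : Fin 4 → Ln   -- {c_u : u ∈ L} for the k-th line L of 𝔑
  aL : P2 → Ln      -- {a_i, a_j, c_{i,j}}
  bL : P2 → Ln      -- {b_i, b_j, c_{δ⁻¹{i,j}}}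
  pL : I₄ → Ln      -- {p, a_i, b_i}

-- incidence of Π(p, δ, 𝔑).  For bL w with w = {i,j}: x lies on it iff
-- x ∈ {b_i, b_j} or x = c_v with δ(v) = w, i.e. v = δ⁻¹(w) (δ is a bijection).
Inc : (δ : P2 → P2) → Veblen → Pt → Ln → Set
Inc δ N pp (cL k) = Data.Empty.⊥
Inc δ N (a _) (cL k) = Data.Empty.⊥
Inc δ N (b _) (cL k) = Data.Empty.⊥
Inc δ N (c u) (cL k) = line N k u ≡ true
Inc δ N pp (aL w) = Data.Empty.⊥
Inc δ N (a i) (aL w) = (i ≡ proj₁ (elems w)) Data.Sum.⊎ (i ≡ proj₂ (elems w))
Inc δ N (b _) (aL w) = Data.Empty.⊥
Inc δ N (c u) (aL w) = u ≡ w
Inc δ N pp (bL w) = Data.Empty.⊥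
Inc δ N (a _) (bL w) = Data.Empty.⊥
Inc δ N (b i) (bL w) = (i ≡ proj₁ (elems w)) Data.Sum.⊎ (i ≡ proj₂ (elems w))
Inc δ N (c v) (bL w) = δ v ≡ w
Inc δ N pp (pL i) = Data.Unit.⊤
Inc δ N (a j) (pL i) = j ≡ i
Inc δ N (b j) (pL i) = j ≡ i
Inc δ N (c _) (pL i) = Data.Empty.⊥

_≅Π_ : (P2 → P2) × Veblen → (P2 → P2) × Veblen → Set
(δ , N) ≅Π (δ' , N') =
  Σ (Pt ↔ Pt) λ f →
    ((L : Ln) → Σ Ln λ L' → (x : Pt) → Inc δ N x L ⇔ Inc δ' N' (Inverse.to f x) L')
    × ((L' : Ln) → Σ Ln λ L → (x : Pt) → Inc δ N x L ⇔ Inc δ' N' (Inverse.to f x) L')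

-- In Π(p, σ̄, 𝔑′) the point p is the centre of a star: its lines are {p, aᵢ, bᵢ}, the aᵢ are
-- mutually collinear and so are the bᵢ. Moreover a₀ and b_{σ(0)} have the three common neighbours
-- c_{01}, c_{02}, c_{03}, none of them collinear with p. An isomorphism onto Π(p, φ̄ϰ, 𝔑) carries
-- both features along. But there c_u is joined to aᵢ iff i ∈ u and to bₑ iff φ⁻¹(e) ∉ u, so at
-- most two c-points are joined to a given a-point and a given b-point. This forces every star
-- centre of Π(p, φ̄ϰ, 𝔑) to be p itself, and then p cannot have the three common neighbours.

module Submission where

open import Defs
open import Data.Product using (Σ; _,_)
open import Relation.Nullary using (¬_)
open import Function using (_∘_)

open import Data.Empty using (⊥; ⊥-elim)
open import Data.Fin using (Fin; zero; suc; _≟_)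
open import Data.Fin.Permutation using (_⟨$⟩ʳ_; _⟨$⟩ˡ_; inverseˡ)
open import Data.Fin.Properties using (all?; any?)
open import Data.Product using (_×_; proj₁; proj₂; ∃₂; map₂)
open import Data.Sum using (_⊎_; inj₁; inj₂; [_,_]′) renaming (map to ⊎-map)
open import Data.Unit using (tt)
open import Function.Bundles using (Inverse; Equivalence; _⇔_)
open import Relation.Binary.Definitions using (DecidableEquality)
open import Relation.Binary.PropositionalEquality using (_≡_; _≢_; refl; sym; trans; cong; subst)
open import Relation.Nullary using (Dec; yes; no)
open import Relation.Nullary.Decidable using (map′; _×-dec_; _⊎-dec_; _→-dec_; ¬?; from-yes)

infix 4 _∈₂_ _∈₂?_

_∈₂_ : I₄ → P2 → Set
i ∈₂ w = i ≡ proj₁ (elems w) ⊎ i ≡ proj₂ (elems w)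

_∈₂?_ : (i : I₄) (w : P2) → Dec (i ∈₂ w)
i ∈₂? w = i ≟ proj₁ (elems w) ⊎-dec i ≟ proj₂ (elems w)

∈₂-no-third : ∀ {i j k} (w : P2) → k ∈₂ w → i ∈₂ w → j ∈₂ w → i ≢ j → k ≡ i ⊎ k ≡ j
∈₂-no-third w (inj₁ p) (inj₁ q) _ _ = inj₁ (trans p (sym q))
∈₂-no-third w (inj₂ p) (inj₂ q) _ _ = inj₁ (trans p (sym q))
∈₂-no-third w (inj₁ p) (inj₂ q) (inj₁ r) _ = inj₂ (trans p (sym r))
∈₂-no-third w (inj₂ p) (inj₁ q) (inj₂ r) _ = inj₂ (trans p (sym r))
∈₂-no-third w (inj₁ p) (inj₂ q) (inj₂ r) i≢j = ⊥-elim (i≢j (trans q (sym r)))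
∈₂-no-third w (inj₂ p) (inj₁ q) (inj₁ r) i≢j = ⊥-elim (i≢j (trans q (sym r)))

∈₂-pair : (i j : I₄) (i≢j : i ≢ j) → i ∈₂ pair i j i≢j × j ∈₂ pair i j i≢j
∈₂-pair zero zero i≢j = ⊥-elim (i≢j refl)
∈₂-pair zero (suc zero) _ = inj₁ refl , inj₂ refl
∈₂-pair zero (suc (suc zero)) _ = inj₁ refl , inj₂ refl
∈₂-pair zero (suc (suc (suc zero))) _ = inj₁ refl , inj₂ refl
∈₂-pair (suc zero) zero _ = inj₂ refl , inj₁ refl
∈₂-pair (suc zero) (suc zero) i≢j = ⊥-elim (i≢j refl)
∈₂-pair (suc zero) (suc (suc zero)) _ = inj₁ refl , inj₂ refl
∈₂-pair (suc zero) (suc (suc (suc zero))) _ = inj₁ refl , inj₂ refl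
∈₂-pair (suc (suc zero)) zero _ = inj₂ refl , inj₁ refl
∈₂-pair (suc (suc zero)) (suc zero) _ = inj₂ refl , inj₁ refl
∈₂-pair (suc (suc zero)) (suc (suc zero)) i≢j = ⊥-elim (i≢j refl)
∈₂-pair (suc (suc zero)) (suc (suc (suc zero))) _ = inj₁ refl , inj₂ refl
∈₂-pair (suc (suc (suc zero))) zero _ = inj₂ refl , inj₁ refl
∈₂-pair (suc (suc (suc zero))) (suc zero) _ = inj₂ refl , inj₁ refl
∈₂-pair (suc (suc (suc zero))) (suc (suc zero)) _ = inj₂ refl , inj₁ refl
∈₂-pair (suc (suc (suc zero))) (suc (suc (suc zero))) i≢j = ⊥-elim (i≢j refl)

∈₂-pair⁻ : ∀ {k} (i j : I₄) (i≢j : i ≢ j) → k ∈₂ pair i j i≢j → k ≡ i ⊎ k ≡ j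
∈₂-pair⁻ i j i≢j k∈ = ∈₂-no-third (pair i j i≢j) k∈ (proj₁ (∈₂-pair i j i≢j)) (proj₂ (∈₂-pair i j i≢j)) i≢j

∈₂-bar : ∀ (φ : S₄) {i} v → i ∈₂ v → φ ⟨$⟩ʳ i ∈₂ bar φ v
∈₂-bar φ v (inj₁ refl) = proj₁ (∈₂-pair _ _ (elems-≢ v ∘ perm-inj φ))
∈₂-bar φ v (inj₂ refl) = proj₂ (∈₂-pair _ _ (elems-≢ v ∘ perm-inj φ))

∈₂-bar⁻ : ∀ (φ : S₄) {k} v → k ∈₂ bar φ v → φ ⟨$⟩ˡ k ∈₂ v
∈₂-bar⁻ φ v k∈ with ∈₂-pair⁻ _ _ (elems-≢ v ∘ perm-inj φ) k∈
... | inj₁ refl = inj₁ (inverseˡ φ)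
... | inj₂ refl = inj₂ (inverseˡ φ)

toFin : P2 → Fin 6
toFin p01 = zero
toFin p02 = suc zero
toFin p03 = suc (suc zero)
toFin p12 = suc (suc (suc zero))
toFin p13 = suc (suc (suc (suc zero)))
toFin p23 = suc (suc (suc (suc (suc zero))))

fromFin : Fin 6 → P2
fromFin zero = p01
fromFin (suc zero) = p02
fromFin (suc (suc zero)) = p03
fromFin (suc (suc (suc zero))) = p12
fromFin (suc (suc (suc (suc zero)))) = p13
fromFin (suc (suc (suc (suc (suc zero))))) = p23

fromFin-toFin : ∀ u → fromFin (toFin u) ≡ u
fromFin-toFin p01 = refl
fromFin-toFin p02 = refl
fromFin-toFin p03 = refl
fromFin-toFin p12 = refl
fromFin-toFin p13 = refl
fromFin-toFin p23 = refl

toFin-injective : ∀ {u v} → toFin u ≡ toFin v → u ≡ v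
toFin-injective {u} {v} eq = trans (sym (fromFin-toFin u)) (trans (cong fromFin eq) (fromFin-toFin v))

_≟₂_ : DecidableEquality P2
u ≟₂ v = map′ toFin-injective (cong toFin) (toFin u ≟ toFin v)

all₂? : {P : P2 → Set} → (∀ u → Dec (P u)) → Dec (∀ u → P u)
all₂? {P} P? =
  map′ (λ ∀P u → subst P (fromFin-toFin u) (∀P (toFin u))) (λ ∀P i → ∀P (fromFin i)) (all? (P? ∘ fromFin))

three-others : (m : I₄) → Σ I₄ λ n₁ → Σ I₄ λ n₂ → Σ I₄ λ n₃ →
               n₁ ≢ m × n₂ ≢ m × n₃ ≢ m × n₁ ≢ n₂ × n₁ ≢ n₃ × n₂ ≢ n₃
three-others = from-yes (all? λ m → any? λ (n₁ : I₄) → any? λ (n₂ : I₄) → any? λ (n₃ : I₄) →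
  ¬? (n₁ ≟ m) ×-dec ¬? (n₂ ≟ m) ×-dec ¬? (n₃ ≟ m) ×-dec ¬? (n₁ ≟ n₂) ×-dec ¬? (n₁ ≟ n₃) ×-dec ¬? (n₂ ≟ n₃))

two-others : (m n : I₄) → m ≢ n → ∃₂ λ r₁ r₂ → r₁ ≢ m × r₁ ≢ n × r₂ ≢ m × r₂ ≢ n × r₁ ≢ r₂
two-others = from-yes (all? λ m → all? λ n → ¬? (m ≟ n) →-dec any? λ (r₁ : I₄) → any? λ (r₂ : I₄) →
  ¬? (r₁ ≟ m) ×-dec ¬? (r₁ ≟ n) ×-dec ¬? (r₂ ≟ m) ×-dec ¬? (r₂ ≟ n) ×-dec ¬? (r₁ ≟ r₂))

Separates : I₄ → I₄ → P2 → Set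
Separates i j u = i ∈₂ u × j ∈₂ ϰ u

-- For i ≢ j the sets separating i from j are {i, k} with k ∉ {i, j}: there are only two.
no-three-separating : ∀ i j u₁ u₂ u₃ → u₁ ≢ u₂ → u₁ ≢ u₃ → u₂ ≢ u₃ →
                      Separates i j u₁ → Separates i j u₂ → ¬ Separates i j u₃
no-three-separating = from-yes (all? λ i → all? λ j → all₂? λ u₁ → all₂? λ u₂ → all₂? λ u₃ →
  ¬? (u₁ ≟₂ u₂) →-dec ¬? (u₁ ≟₂ u₃) →-dec ¬? (u₂ ≟₂ u₃) →-dec
  separates? i j u₁ →-dec separates? i j u₂ →-dec ¬? (separates? i j u₃))
  where
  separates? : ∀ i j u → Dec (Separates i j u)
  separates? i j u = i ∈₂? u ×-dec j ∈₂? ϰ u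

data Kind : Set where
  α β : Kind

other : Kind → Kind
other α = β
other β = α

same-or-other : ∀ κ κ′ → κ′ ≡ κ ⊎ κ′ ≡ other κ
same-or-other α α = inj₁ refl
same-or-other α β = inj₂ refl
same-or-other β α = inj₂ refl
same-or-other β β = inj₁ refl

point : Kind → I₄ → Pt
point α = a
point β = b

kindLine : Kind → P2 → Ln
kindLine α = aL
kindLine β = bL

point≢pp : ∀ κ {i} → point κ i ≢ pp
point≢pp α ()
point≢pp β ()

≡c-apart : ∀ {x y u v} → x ≢ y → x ≡ c u → y ≡ c v → u ≢ v
≡c-apart x≢y refl refl refl = x≢y refl

-- c_u and point κ i lie on a common line of Π(p, δ, 𝔑).
Joined : (P2 → P2) → Kind → I₄ → P2 → Set
Joined δ α i u = i ∈₂ u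
Joined δ β i u = i ∈₂ δ u

Bridges : (P2 → P2) → Kind → I₄ → I₄ → P2 → Set
Bridges δ κ i e u = Joined δ κ i u × Joined δ (other κ) e u

Thin : (P2 → P2) → Set
Thin δ = ∀ κ {i e u₁ u₂ u₃} → u₁ ≢ u₂ → u₁ ≢ u₃ → u₂ ≢ u₃ →
         Bridges δ κ i e u₁ → Bridges δ κ i e u₂ → ¬ Bridges δ κ i e u₃

thin-bar∘ϰ : (φ : S₄) → Thin (bar φ ∘ ϰ)
thin-bar∘ϰ φ α {u₁ = u₁} {u₂} {u₃} d₁₂ d₁₃ d₂₃ (i₁ , e₁) (i₂ , e₂) (i₃ , e₃) =
  no-three-separating _ _ u₁ u₂ u₃ d₁₂ d₁₃ d₂₃
    (i₁ , ∈₂-bar⁻ φ (ϰ u₁) e₁) (i₂ , ∈₂-bar⁻ φ (ϰ u₂) e₂) (i₃ , ∈₂-bar⁻ φ (ϰ u₃) e₃)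
thin-bar∘ϰ φ β {u₁ = u₁} {u₂} {u₃} d₁₂ d₁₃ d₂₃ (i₁ , e₁) (i₂ , e₂) (i₃ , e₃) =
  no-three-separating _ _ u₁ u₂ u₃ d₁₂ d₁₃ d₂₃
    (e₁ , ∈₂-bar⁻ φ (ϰ u₁) i₁) (e₂ , ∈₂-bar⁻ φ (ϰ u₂) i₂) (e₃ , ∈₂-bar⁻ φ (ϰ u₃) i₃)

module IncidenceStructure {Point Line : Set} (I : Point → Line → Set) where

  ≡-incident : ∀ {x y ℓ} → x ≡ y → I x ℓ → I y ℓ
  ≡-incident refl x∈ = x∈

  Collinear : Point → Point → Set
  Collinear x y = Σ Line λ ℓ → I x ℓ × I y ℓ

  collinear-sym : ∀ {x y} → Collinear x y → Collinear y x
  collinear-sym (ℓ , x∈ , y∈) = ℓ , y∈ , x∈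

  ≡-collinear : ∀ {x x′ y y′} → x ≡ x′ → y ≡ y′ → Collinear x y → Collinear x′ y′
  ≡-collinear refl refl xy = xy

  record Star (x : Point) (S T : I₄ → Point) : Set where
    field
      S-injective : ∀ {m n} → S m ≡ S n → m ≡ n
      T-injective : ∀ {m n} → T m ≡ T n → m ≡ n
      S≢T         : ∀ m n → S m ≢ T n
      S≢x         : ∀ m → S m ≢ x
      T≢x         : ∀ m → T m ≢ x
      ray         : ∀ m → Σ Line λ ℓ → I x ℓ × I (S m) ℓ × I (T m) ℓ
      S-collinear : ∀ {m n} → m ≢ n → Collinear (S m) (S n)
      T-collinear : ∀ {m n} → m ≢ n → Collinear (T m) (T n)
      neighbours  : ∀ {ℓ z} → I x ℓ → I z ℓ → z ≡ x ⊎ Σ I₄ λ m → z ≡ S m ⊎ z ≡ T m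

  star-swap : ∀ {x S T} → Star x S T → Star x T S
  star-swap st = record
    { S-injective = T-injective
    ; T-injective = S-injective
    ; S≢T         = λ m n eq → S≢T n m (sym eq)
    ; S≢x         = T≢x
    ; T≢x         = S≢x
    ; ray         = λ m → let (ℓ , x∈ , S∈ , T∈) = ray m in ℓ , x∈ , T∈ , S∈
    ; S-collinear = T-collinear
    ; T-collinear = S-collinear
    ; neighbours  = λ x∈ z∈ → [ inj₁ , (λ (m , z≡) → inj₂ (m , [ inj₂ , inj₁ ]′ z≡)) ]′ (neighbours x∈ z∈)
    }
    where open Star st

  RemoteCommonNeighbour : Point → Point → Point → Point → Set
  RemoteCommonNeighbour x y z w = Collinear y w × Collinear z w × ¬ Collinear x w

  record LinkedNeighbours (x : Point) : Set where
    field
      y z             : Point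
      y≢z             : y ≢ z
      x~y             : Collinear x y
      x~z             : Collinear x z
      lines-through-x : ∀ {ℓ} → I y ℓ → I z ℓ → I x ℓ
      w₁ w₂ w₃        : Point
      w₁≢w₂           : w₁ ≢ w₂
      w₁≢w₃           : w₁ ≢ w₃
      w₂≢w₃           : w₂ ≢ w₃
      remote₁         : RemoteCommonNeighbour x y z w₁
      remote₂         : RemoteCommonNeighbour x y z w₂
      remote₃         : RemoteCommonNeighbour x y z w₃

module Lines (δ : P2 → P2) (M : Veblen) where
  open IncidenceStructure (Inc δ M)

  point-on-pL : ∀ κ i → Inc δ M (point κ i) (pL i)
  point-on-pL α i = refl
  point-on-pL β i = refl

  point-on-kindLine : ∀ κ {i w} → i ∈₂ w → Inc δ M (point κ i) (kindLine κ w)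
  point-on-kindLine α i∈ = i∈
  point-on-kindLine β i∈ = i∈

  pp-not-on-kindLine : ∀ κ {w} → ¬ Inc δ M pp (kindLine κ w)
  pp-not-on-kindLine α ()
  pp-not-on-kindLine β ()

  ¬pp-c-collinear : ∀ {u} → ¬ Collinear pp (c u)
  ¬pp-c-collinear (cL _ , () , _)
  ¬pp-c-collinear (aL _ , () , _)
  ¬pp-c-collinear (bL _ , () , _)
  ¬pp-c-collinear (pL _ , _ , ())

  ¬pp-collinear⇒c : ∀ w → ¬ Collinear pp w → Σ P2 λ u → w ≡ c u
  ¬pp-collinear⇒c pp ¬pw = ⊥-elim (¬pw (pL zero , tt , tt))
  ¬pp-collinear⇒c (a i) ¬pw = ⊥-elim (¬pw (pL i , tt , refl))
  ¬pp-collinear⇒c (b i) ¬pw = ⊥-elim (¬pw (pL i , tt , refl))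
  ¬pp-collinear⇒c (c u) _ = u , refl

  pp-collinear⇒point : ∀ {z} → Collinear pp z → z ≡ pp ⊎ Σ Kind λ κ → Σ I₄ λ k → z ≡ point κ k
  pp-collinear⇒point {pp} _ = inj₁ refl
  pp-collinear⇒point {a k} _ = inj₂ (α , k , refl)
  pp-collinear⇒point {b k} _ = inj₂ (β , k , refl)
  pp-collinear⇒point {c u} pz = ⊥-elim (¬pp-c-collinear pz)

  collinear⇒joined : ∀ κ {i u} → Collinear (point κ i) (c u) → Joined δ κ i u
  collinear⇒joined α (aL _ , i∈ , refl) = i∈
  collinear⇒joined α (cL _ , () , _)
  collinear⇒joined α (bL _ , () , _)
  collinear⇒joined α (pL _ , _ , ())
  collinear⇒joined β (bL _ , i∈ , refl) = i∈
  collinear⇒joined β (cL _ , () , _)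
  collinear⇒joined β (aL _ , () , _)
  collinear⇒joined β (pL _ , _ , ())

  collinear⇒same-index : ∀ κ {i j} → Collinear (point κ i) (point (other κ) j) → i ≡ j
  collinear⇒same-index α (pL _ , refl , refl) = refl
  collinear⇒same-index α (cL _ , () , _)
  collinear⇒same-index α (aL _ , _ , ())
  collinear⇒same-index α (bL _ , () , _)
  collinear⇒same-index β (pL _ , refl , refl) = refl
  collinear⇒same-index β (cL _ , () , _)
  collinear⇒same-index β (aL _ , () , _)
  collinear⇒same-index β (bL _ , _ , ())

  a-b-line-through-pp : ∀ {i j ℓ} → Inc δ M (a i) ℓ → Inc δ M (b j) ℓ → Inc δ M pp ℓ
  a-b-line-through-pp {ℓ = pL _} _ _ = tt
  a-b-line-through-pp {ℓ = cL _} () _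
  a-b-line-through-pp {ℓ = aL _} _ ()
  a-b-line-through-pp {ℓ = bL _} () _

  pL-points : ∀ {z j} → Inc δ M z (pL j) → z ≡ pp ⊎ z ≡ a j ⊎ z ≡ b j
  pL-points {pp} _ = inj₁ refl
  pL-points {a _} refl = inj₂ (inj₁ refl)
  pL-points {b _} refl = inj₂ (inj₂ refl)

  pp-point-line : ∀ κ {k z ℓ} → Inc δ M pp ℓ → Inc δ M (point κ k) ℓ → Inc δ M z ℓ →
                  z ≡ pp ⊎ z ≡ point κ k ⊎ z ≡ point (other κ) k
  pp-point-line κ {ℓ = cL _} () _ _
  pp-point-line κ {ℓ = aL _} () _ _
  pp-point-line κ {ℓ = bL _} () _ _
  pp-point-line α {ℓ = pL _} _ refl z∈ = pL-points z∈
  pp-point-line β {ℓ = pL _} _ refl z∈ = [ inj₁ , (λ z≡ → inj₂ ([ inj₂ , inj₁ ]′ z≡)) ]′ (pL-points z∈)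

  same-kind-line : ∀ κ {i k z ℓ} → Inc δ M (point κ i) ℓ → Inc δ M (point κ k) ℓ → i ≢ k → Inc δ M z ℓ →
                   z ≡ point κ i ⊎ z ≡ point κ k ⊎ Σ P2 λ w → z ≡ c w
  same-kind-line κ {z = c w} _ _ _ _ = inj₂ (inj₂ (w , refl))
  same-kind-line α {ℓ = pL _} refl refl i≢k _ = ⊥-elim (i≢k refl)
  same-kind-line β {ℓ = pL _} refl refl i≢k _ = ⊥-elim (i≢k refl)
  same-kind-line α {z = a x} {aL w} i∈ k∈ i≢k x∈ =
    [ inj₁ ∘ cong a , inj₂ ∘ inj₁ ∘ cong a ]′ (∈₂-no-third w x∈ i∈ k∈ i≢k)
  same-kind-line β {z = b x} {bL w} i∈ k∈ i≢k x∈ =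
    [ inj₁ ∘ cong b , inj₂ ∘ inj₁ ∘ cong b ]′ (∈₂-no-third w x∈ i∈ k∈ i≢k)
  same-kind-line α {ℓ = cL _} () _ _ _
  same-kind-line α {ℓ = bL _} () _ _ _
  same-kind-line α {z = pp} {aL _} _ _ _ ()
  same-kind-line α {z = b _} {aL _} _ _ _ ()
  same-kind-line β {ℓ = cL _} () _ _ _
  same-kind-line β {ℓ = aL _} () _ _ _
  same-kind-line β {z = pp} {bL _} _ _ _ ()
  same-kind-line β {z = a _} {bL _} _ _ _ ()

  c-a-line : ∀ {u e z ℓ} → Inc δ M (c u) ℓ → Inc δ M (a e) ℓ → Inc δ M z ℓ →
             z ≡ c u ⊎ Σ I₄ λ j → z ≡ a j × j ∈₂ u
  c-a-line {ℓ = cL _} _ () _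
  c-a-line {ℓ = bL _} _ () _
  c-a-line {ℓ = pL _} () _ _
  c-a-line {z = pp} {aL _} _ _ ()
  c-a-line {z = a j} {aL _} refl _ j∈ = inj₂ (j , refl , j∈)
  c-a-line {z = b _} {aL _} _ _ ()
  c-a-line {z = c _} {aL _} refl _ refl = inj₁ refl

star-at-pp : (δ : P2 → P2) (M : Veblen) → IncidenceStructure.Star (Inc δ M) pp a b
star-at-pp δ M = record
  { S-injective = λ { refl → refl }
  ; T-injective = λ { refl → refl }
  ; S≢T         = λ _ _ ()
  ; S≢x         = λ _ ()
  ; T≢x         = λ _ ()
  ; ray         = λ m → pL m , tt , refl , refl
  ; S-collinear = λ {m} {n} m≢n → aL (pair m n m≢n) , ∈₂-pair m n m≢n
  ; T-collinear = λ {m} {n} m≢n → bL (pair m n m≢n) , ∈₂-pair m n m≢n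
  ; neighbours  = λ p∈ z∈ → [ inj₁ , inj₂ ∘ neighbour ]′ (pp-collinear⇒point (_ , p∈ , z∈))
  }
  where
  open Lines δ M
  neighbour : ∀ {z} → Σ Kind (λ κ → Σ I₄ λ k → z ≡ point κ k) → Σ I₄ λ m → z ≡ a m ⊎ z ≡ b m
  neighbour (α , k , z≡) = k , inj₁ z≡
  neighbour (β , k , z≡) = k , inj₂ z≡

linked-at-pp : (σ : S₄) (M : Veblen) → IncidenceStructure.LinkedNeighbours (Inc (bar σ) M) pp
linked-at-pp σ M = record
  { y               = a zero
  ; z               = b (σ ⟨$⟩ʳ zero)
  ; y≢z             = λ ()
  ; x~y             = pL zero , tt , refl
  ; x~z             = pL (σ ⟨$⟩ʳ zero) , tt , refl
  ; lines-through-x = a-b-line-through-pp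
  ; w₁ = c p01 ; w₂ = c p02 ; w₃ = c p03
  ; w₁≢w₂ = λ () ; w₁≢w₃ = λ () ; w₂≢w₃ = λ ()
  ; remote₁ = remote p01 (inj₁ refl)
  ; remote₂ = remote p02 (inj₁ refl)
  ; remote₃ = remote p03 (inj₁ refl)
  }
  where
  open IncidenceStructure (Inc (bar σ) M)
  open Lines (bar σ) M
  remote : ∀ v → zero ∈₂ v → RemoteCommonNeighbour pp (a zero) (b (σ ⟨$⟩ʳ zero)) (c v)
  remote v 0∈v = (aL v , 0∈v , refl) , (bL (bar σ v) , ∈₂-bar σ v 0∈v , refl) , ¬pp-c-collinear

module Transport {δ δ′ : P2 → P2} {M M′ : Veblen} (iso : (δ , M) ≅Π (δ′ , M′)) where
  private
    module A = IncidenceStructure (Inc δ M)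
    module B = IncidenceStructure (Inc δ′ M′)

    to : Pt → Pt
    to = Inverse.to (proj₁ iso)

  from : Pt → Pt
  from = Inverse.from (proj₁ iso)

  private
    to-from : ∀ y → to (from y) ≡ y
    to-from = Inverse.strictlyInverseˡ (proj₁ iso)

    from-to : ∀ x → from (to x) ≡ x
    from-to = Inverse.strictlyInverseʳ (proj₁ iso)

  from-injective : ∀ {y z} → from y ≡ from z → y ≡ z
  from-injective {y} {z} eq = trans (sym (to-from y)) (trans (cong to eq) (to-from z))

  Corresponding : Ln → Ln → Set
  Corresponding ℓ ℓ′ = ∀ y → Inc δ M (from y) ℓ ⇔ Inc δ′ M′ y ℓ′

  private
    corresponding : ∀ {ℓ ℓ′} → (∀ x → Inc δ M x ℓ ⇔ Inc δ′ M′ (to x) ℓ′) → Corresponding ℓ ℓ′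
    corresponding {ℓ} {ℓ′} f⇔ y = subst (λ t → Inc δ M (from y) ℓ ⇔ Inc δ′ M′ t ℓ′) (to-from y) (f⇔ (from y))

  image : ∀ ℓ → Σ Ln (Corresponding ℓ)
  image ℓ = map₂ corresponding (proj₁ (proj₂ iso) ℓ)

  preimage : ∀ ℓ′ → Σ Ln λ ℓ → Corresponding ℓ ℓ′
  preimage ℓ′ = map₂ corresponding (proj₂ (proj₂ iso) ℓ′)

  collinear-preimage : ∀ {y z} → B.Collinear y z → A.Collinear (from y) (from z)
  collinear-preimage (ℓ′ , y∈ , z∈) with preimage ℓ′
  ... | ℓ , corr = ℓ , Equivalence.from (corr _) y∈ , Equivalence.from (corr _) z∈

  collinear-image : ∀ {y z} → A.Collinear (from y) (from z) → B.Collinear y z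
  collinear-image (ℓ , y∈ , z∈) with image ℓ
  ... | ℓ′ , corr = ℓ′ , Equivalence.to (corr _) y∈ , Equivalence.to (corr _) z∈

  star-preimage : ∀ {y S T} → B.Star y S T → A.Star (from y) (from ∘ S) (from ∘ T)
  star-preimage {y} {S} {T} st = record
    { S-injective = S-injective ∘ from-injective
    ; T-injective = T-injective ∘ from-injective
    ; S≢T         = λ m n → S≢T m n ∘ from-injective
    ; S≢x         = λ m → S≢x m ∘ from-injective
    ; T≢x         = λ m → T≢x m ∘ from-injective
    ; ray         = ray′
    ; S-collinear = collinear-preimage ∘ S-collinear
    ; T-collinear = collinear-preimage ∘ T-collinear
    ; neighbours  = neighbours′
    }
    where
    open B.Star st

    ray′ : ∀ m → Σ Ln λ ℓ → Inc δ M (from y) ℓ × Inc δ M (from (S m)) ℓ × Inc δ M (from (T m)) ℓ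
    ray′ m with ray m
    ... | ℓ′ , y∈ , S∈ , T∈ with preimage ℓ′
    ...   | ℓ , corr = ℓ , Equivalence.from (corr _) y∈ , Equivalence.from (corr _) S∈ , Equivalence.from (corr _) T∈

    moved : ∀ {z w} → to z ≡ w → z ≡ from w
    moved {z} eq = trans (sym (from-to z)) (cong from eq)

    neighbours′ : ∀ {ℓ z} → Inc δ M (from y) ℓ → Inc δ M z ℓ →
                  z ≡ from y ⊎ Σ I₄ λ m → z ≡ from (S m) ⊎ z ≡ from (T m)
    neighbours′ {ℓ} {z} y∈ z∈ with image ℓ
    ... | ℓ′ , corr =
      ⊎-map moved (map₂ (⊎-map moved moved))
        (neighbours (Equivalence.to (corr y) y∈) (Equivalence.to (corr (to z)) (A.≡-incident (sym (from-to z)) z∈)))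

  linked-preimage : ∀ {x} → B.LinkedNeighbours x → A.LinkedNeighbours (from x)
  linked-preimage {x} ln = record
    { y               = from y
    ; z               = from z
    ; y≢z             = y≢z ∘ from-injective
    ; x~y             = collinear-preimage x~y
    ; x~z             = collinear-preimage x~z
    ; lines-through-x = lines-through-x′
    ; w₁ = from w₁ ; w₂ = from w₂ ; w₃ = from w₃
    ; w₁≢w₂ = w₁≢w₂ ∘ from-injective
    ; w₁≢w₃ = w₁≢w₃ ∘ from-injective
    ; w₂≢w₃ = w₂≢w₃ ∘ from-injective
    ; remote₁ = remote-preimage remote₁
    ; remote₂ = remote-preimage remote₂
    ; remote₃ = remote-preimage remote₃
    }
    where
    open B.LinkedNeighbours ln

    lines-through-x′ : ∀ {ℓ} → Inc δ M (from y) ℓ → Inc δ M (from z) ℓ → Inc δ M (from x) ℓ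
    lines-through-x′ {ℓ} y∈ z∈ with image ℓ
    ... | ℓ′ , corr = Equivalence.from (corr x) (lines-through-x (Equivalence.to (corr y) y∈) (Equivalence.to (corr z) z∈))

    remote-preimage : ∀ {w} → B.RemoteCommonNeighbour x y z w → A.RemoteCommonNeighbour (from x) (from y) (from z) (from w)
    remote-preimage (y~w , z~w , x≁w) = collinear-preimage y~w , collinear-preimage z~w , x≁w ∘ collinear-image

module ThinConfiguration {δ : P2 → P2} (thin : Thin δ) (M : Veblen) where
  open IncidenceStructure (Inc δ M)
  open Lines δ M

  ¬bridging-family : ∀ κ {i e m₀} {T : I₄ → Pt} → (∀ {m n} → T m ≡ T n → m ≡ n) →
                     (∀ n → n ≢ m₀ → Σ P2 λ w → T n ≡ c w × Bridges δ κ i e w) → ⊥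
  ¬bridging-family κ {m₀ = m₀} {T} T-injective bridge with three-others m₀
  ... | n₁ , n₂ , n₃ , n₁≢m₀ , n₂≢m₀ , n₃≢m₀ , n₁≢n₂ , n₁≢n₃ , n₂≢n₃
    with bridge n₁ n₁≢m₀ | bridge n₂ n₂≢m₀ | bridge n₃ n₃≢m₀
  ... | w₁ , T₁≡ , b₁ | w₂ , T₂≡ , b₂ | w₃ , T₃≡ , b₃ =
    thin κ (≡c-apart (n₁≢n₂ ∘ T-injective) T₁≡ T₂≡) (≡c-apart (n₁≢n₃ ∘ T-injective) T₁≡ T₃≡)
           (≡c-apart (n₂≢n₃ ∘ T-injective) T₂≡ T₃≡) b₁ b₂ b₃

  ¬star-at-point-with-S≡pp : ∀ κ {i S T m₀} → Star (point κ i) S T → S m₀ ≡ pp → ⊥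
  ¬star-at-point-with-S≡pp κ {i} {S} {T} {m₀} st S₀≡pp = ¬bridging-family κ T-injective bridge
    where
    open Star st

    ray-S : ∀ n → Collinear (point κ i) (S n)
    ray-S n = let (ℓ , x∈ , S∈ , _) = ray n in ℓ , x∈ , S∈

    T₀≡ : T m₀ ≡ point (other κ) i
    T₀≡ with ray m₀
    ... | ℓ , x∈ , S∈ , T∈ with pp-point-line κ (≡-incident S₀≡pp S∈) x∈ T∈
    ...   | inj₁ T≡pp = ⊥-elim (S≢T m₀ m₀ (trans S₀≡pp (sym T≡pp)))
    ...   | inj₂ (inj₁ T≡x) = ⊥-elim (T≢x m₀ T≡x)
    ...   | inj₂ (inj₂ T≡) = T≡

    S-same-kind : ∀ n → n ≢ m₀ → Σ I₄ λ k → S n ≡ point κ k × k ≢ i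
    S-same-kind n n≢m₀ with S-collinear (n≢m₀ ∘ sym)
    ... | ℓ , S₀∈ , Sn∈ with pp-collinear⇒point (ℓ , ≡-incident S₀≡pp S₀∈ , Sn∈)
    ...   | inj₁ Sn≡pp = ⊥-elim (n≢m₀ (S-injective (trans Sn≡pp (sym S₀≡pp))))
    ...   | inj₂ (κ′ , k , Sn≡) with same-or-other κ κ′
    ...     | inj₁ refl = k , Sn≡ , λ { refl → S≢x n Sn≡ }
    ...     | inj₂ refl = ⊥-elim (S≢T n m₀ (trans Sn≡ (trans (cong (point (other κ)) (sym i≡k)) (sym T₀≡))))
      where
      i≡k : i ≡ k
      i≡k = collinear⇒same-index κ (≡-collinear refl Sn≡ (ray-S n))

    bridge : ∀ n → n ≢ m₀ → Σ P2 λ w → T n ≡ c w × Bridges δ κ i i w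
    bridge n n≢m₀ with S-same-kind n n≢m₀ | ray n
    ... | k , Sn≡ , k≢i | ℓ , x∈ , S∈ , T∈ with same-kind-line κ x∈ (≡-incident Sn≡ S∈) (k≢i ∘ sym) T∈
    ...   | inj₁ T≡x = ⊥-elim (T≢x n T≡x)
    ...   | inj₂ (inj₁ T≡S) = ⊥-elim (S≢T n n (trans Sn≡ (sym T≡S)))
    ...   | inj₂ (inj₂ (w , T≡c)) =
      w , T≡c , collinear⇒joined κ (ℓ , x∈ , ≡-incident T≡c T∈)
              , collinear⇒joined (other κ) (≡-collinear T₀≡ T≡c (T-collinear (n≢m₀ ∘ sym)))

  ¬star-at-point : ∀ κ {i S T} → ¬ Star (point κ i) S T
  ¬star-at-point κ {i} st with Star.neighbours st (point-on-pL κ i) tt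
  ... | inj₁ pp≡x = point≢pp κ (sym pp≡x)
  ... | inj₂ (m , inj₁ pp≡S) = ¬star-at-point-with-S≡pp κ st (sym pp≡S)
  ... | inj₂ (m , inj₂ pp≡T) = ¬star-at-point-with-S≡pp κ (star-swap st) (sym pp≡T)

  ¬star-at-c-with-S≡a,b : ∀ {u e e′ S T m n} → Star (c u) S T → S m ≡ a e → S n ≡ b e′ →
                          e ∈₂ u → e′ ∈₂ δ u → ⊥
  ¬star-at-c-with-S≡a,b {u} {e} {e′} {S} {T} {m} {n} st Sm≡ Sn≡ e∈u e′∈δu = contradiction
    where
    open Star st

    m≢n : m ≢ n
    m≢n refl with trans (sym Sm≡) Sn≡
    ... | ()

    e≡e′ : e ≡ e′
    e≡e′ = collinear⇒same-index α (≡-collinear Sm≡ Sn≡ (S-collinear m≢n))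

    bridge : ∀ r → r ≢ m → r ≢ n → Σ P2 λ v → S r ≡ c v × Bridges δ α e e v × v ≢ u
    bridge r r≢m r≢n = classify (S r) refl
      where
      classify : ∀ z → S r ≡ z → Σ P2 λ v → S r ≡ c v × Bridges δ α e e v × v ≢ u
      classify pp Sr≡ = ⊥-elim (¬pp-c-collinear (let (ℓ , x∈ , S∈ , _) = ray r in ℓ , ≡-incident Sr≡ S∈ , x∈))
      classify (a j) Sr≡ = ⊥-elim (r≢m (S-injective (trans Sr≡ (trans (cong a j≡e) (sym Sm≡)))))
        where
        j≡e : j ≡ e
        j≡e = trans (collinear⇒same-index α (collinear-sym (≡-collinear Sn≡ Sr≡ (S-collinear (r≢n ∘ sym))))) (sym e≡e′)
      classify (b j) Sr≡ = ⊥-elim (r≢n (S-injective (trans Sr≡ (trans (cong b j≡e′) (sym Sn≡)))))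
        where
        j≡e′ : j ≡ e′
        j≡e′ = trans (sym (collinear⇒same-index α (≡-collinear Sm≡ Sr≡ (S-collinear (r≢m ∘ sym))))) e≡e′
      classify (c v) Sr≡ =
        v , Sr≡ , ( collinear⇒joined α (≡-collinear Sm≡ Sr≡ (S-collinear (r≢m ∘ sym)))
                  , collinear⇒joined β (≡-collinear (trans Sn≡ (cong b (sym e≡e′))) Sr≡ (S-collinear (r≢n ∘ sym))))
          , λ { refl → S≢x r Sr≡ }

    contradiction : ⊥
    contradiction with two-others m n m≢n
    ... | r₁ , r₂ , r₁≢m , r₁≢n , r₂≢m , r₂≢n , r₁≢r₂ with bridge r₁ r₁≢m r₁≢n | bridge r₂ r₂≢m r₂≢n
    ...   | v₁ , Sr₁≡ , b₁ , v₁≢u | v₂ , Sr₂≡ , b₂ , v₂≢u =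
      thin α (v₁≢u ∘ sym) (v₂≢u ∘ sym) (≡c-apart (r₁≢r₂ ∘ S-injective) Sr₁≡ Sr₂≡)
        (e∈u , subst (λ t → t ∈₂ δ u) (sym e≡e′) e′∈δu) b₁ b₂

  ¬star-at-c-with-S≡a : ∀ {u e S T m} → Star (c u) S T → S m ≡ a e → e ∈₂ u → ⊥
  ¬star-at-c-with-S≡a {u} {e} {S} {T} {m} st Sm≡ e∈u with Star.ray st m
  ... | ℓ , x∈ , S∈ , T∈ with c-a-line x∈ (≡-incident Sm≡ S∈) T∈
  ...   | inj₁ Tm≡x = Star.T≢x st m Tm≡x
  ...   | inj₂ (j , Tm≡ , j∈u) with Star.neighbours st {bL (δ u)} {b (proj₁ (elems (δ u)))} refl (inj₁ refl)
  ...     | inj₁ ()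
  ...     | inj₂ (n , inj₁ b≡Sn) = ¬star-at-c-with-S≡a,b st Sm≡ (sym b≡Sn) e∈u (inj₁ refl)
  ...     | inj₂ (n , inj₂ b≡Tn) = ¬star-at-c-with-S≡a,b (star-swap st) Tm≡ (sym b≡Tn) j∈u (inj₁ refl)

  ¬star-at-c : ∀ {u S T} → ¬ Star (c u) S T
  ¬star-at-c {u} st with Star.neighbours st {aL u} {a (proj₁ (elems u))} refl (inj₁ refl)
  ... | inj₁ ()
  ... | inj₂ (m , inj₁ a≡Sm) = ¬star-at-c-with-S≡a st (sym a≡Sm) (inj₁ refl)
  ... | inj₂ (m , inj₂ a≡Tm) = ¬star-at-c-with-S≡a (star-swap st) (sym a≡Tm) (inj₁ refl)

  star-centre≡pp : ∀ {x S T} → Star x S T → x ≡ pp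
  star-centre≡pp {pp} _ = refl
  star-centre≡pp {a _} st = ⊥-elim (¬star-at-point α st)
  star-centre≡pp {b _} st = ⊥-elim (¬star-at-point β st)
  star-centre≡pp {c _} st = ⊥-elim (¬star-at-c st)

  ¬linked-at-pp : ¬ LinkedNeighbours pp
  ¬linked-at-pp ln = by-cases (pp-collinear⇒point x~y) (pp-collinear⇒point x~z)
    where
    open LinkedNeighbours ln

    bridged : ∀ {κ k l w} → y ≡ point κ k → z ≡ point (other κ) l → RemoteCommonNeighbour pp y z w →
              Σ P2 λ u → w ≡ c u × Bridges δ κ k l u
    bridged {κ} {w = w} y≡ z≡ (y~w , z~w , pp≁w) with ¬pp-collinear⇒c w pp≁w
    ... | u , w≡ = u , w≡ , collinear⇒joined κ (≡-collinear y≡ w≡ y~w) , collinear⇒joined (other κ) (≡-collinear z≡ w≡ z~w)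

    by-kinds : ∀ {κ κ′ k l} → y ≡ point κ k → z ≡ point κ′ l → κ′ ≡ κ ⊎ κ′ ≡ other κ → ⊥
    by-kinds {κ} {k = k} {l} y≡ z≡ (inj₁ refl) with k ≟ l
    ... | yes refl = y≢z (trans y≡ (sym z≡))
    ... | no k≢l = pp-not-on-kindLine κ (lines-through-x (on-line y≡ (proj₁ (∈₂-pair k l k≢l)))
                                                         (on-line z≡ (proj₂ (∈₂-pair k l k≢l))))
      where
      on-line : ∀ {x i} → x ≡ point κ i → i ∈₂ pair k l k≢l → Inc δ M x (kindLine κ (pair k l k≢l))
      on-line x≡ i∈ = ≡-incident (sym x≡) (point-on-kindLine κ i∈)
    by-kinds {κ} y≡ z≡ (inj₂ refl)
      with bridged y≡ z≡ remote₁ | bridged y≡ z≡ remote₂ | bridged y≡ z≡ remote₃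
    ... | u₁ , w₁≡ , b₁ | u₂ , w₂≡ , b₂ | u₃ , w₃≡ , b₃ =
      thin κ (≡c-apart w₁≢w₂ w₁≡ w₂≡) (≡c-apart w₁≢w₃ w₁≡ w₃≡) (≡c-apart w₂≢w₃ w₂≡ w₃≡) b₁ b₂ b₃

    remote-not-pp : ∀ {x w} → Collinear x w → ¬ Collinear pp w → x ≢ pp
    remote-not-pp x~w pp≁w x≡pp = pp≁w (≡-collinear x≡pp refl x~w)

    by-cases : y ≡ pp ⊎ Σ Kind (λ κ → Σ I₄ λ k → y ≡ point κ k) →
               z ≡ pp ⊎ Σ Kind (λ κ → Σ I₄ λ k → z ≡ point κ k) → ⊥
    by-cases (inj₁ y≡pp) _ = remote-not-pp (proj₁ remote₁) (proj₂ (proj₂ remote₁)) y≡pp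
    by-cases _ (inj₁ z≡pp) = remote-not-pp (proj₁ (proj₂ remote₁)) (proj₂ (proj₂ remote₁)) z≡pp
    by-cases (inj₂ (κ , k , y≡)) (inj₂ (κ′ , l , z≡)) = by-kinds y≡ z≡ (same-or-other κ κ′)

lemma4p3 : (N : Veblen) (φ : S₄) →
    ¬ (Σ S₄ λ σ → Σ Veblen λ N' → (bar φ ∘ ϰ , N) ≅Π (bar σ , N'))
lemma4p3 N φ (σ , N' , iso) = ¬linked-at-pp (subst LinkedNeighbours p-fixed (linked-preimage (linked-at-pp σ N')))
  where
  open Transport iso
  open ThinConfiguration (thin-bar∘ϰ φ) N
  open IncidenceStructure (Inc (bar φ ∘ ϰ) N)
  p-fixed : from pp ≡ pp
  p-fixed = star-centre≡pp (star-preimage (star-at-pp (bar σ) N'))
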